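{- The decomposition of the interior of the pipe dream complex $\Delta(\mathcal Q_{0,n}, w)$ into the disjoint union of the interiors of the slide complexes $\widetilde\Delta(\mathcal Q_{0,n},\mathcal S)$, where $\mathcal S$ ranges over words with $\widetilde\delta(\mathcal S)=\mathcal S$ and $\delta(\mathcal S)=w$, is consistent with the decomposition of the set $\mathrm{PD}(w)$ into glide orbits $\mathrm{dst}^{ -1}(Q)$, $Q\in\mathrm{QPD}(w)$: the pipe dreams from each glide orbit bijectively correspond to the pipe dreams (faces) from the interior part of the corresponding slide complex.
   Context: Pipe dreams: $n\times n$ squares filled with crosses and elbows, crosses strictly above the antidiagonal; reduced if each pair of strands crosses at most once; $\mathrm{reduct}(P)$ replaces repeated crossings (reading rows top to bottom, each right to left) by elbows; the shape of $P$ is the permutation of $\mathrm{reduct}(P)$; $\mathrm{PD}(w)$ is the set of pipe dreams of shape $w\in\mathbf S_n$. Slide move $S_i$: if the leftmost cross in row $i$ is not in column 1 and lies strictly to the right of the rightmost cross in row $i+1$, move it one step southwest (to $(i+1,j-1)$, merging with a cross already there if any); otherwise $S_i$ acts identically. $P$ is quasi-Yamanouchi if all $S_i$ act identically on it; $\mathrm{QPD}(w)$ is the set of quasi-Yamanouchi pipe dreams of shape $w$. The destandardization $\mathrm{dst}:\mathrm{PD}(w)\to\mathrm{QPD}(w)$ applies slide moves repeatedly until a quasi-Yamanouchi pipe dream is reached (well defined); $\mathrm{dst}^{ -1}(Q)$ is the glide orbit of $Q$. Words: $\mathcal Q_{0,n}=(s_{n-1}\dots s_2s_1)(s_{n-1}\dots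 s_2)\dots(s_{n-1}s_{n-2})(s_{n-1})$, obtained by reading, right to left and top to bottom, the staircase table whose cell $(i,j)$ contains $s_{i+j-1}$; $\mathrm{word}(P)$ is the subword of $\mathcal Q_{0,n}$ formed by the letters in the cells of the crosses of $P$. For a word $\mathcal Q$ and $\pi\in\mathbf S_n$, the subword complex $\Delta(\mathcal Q,\pi)$ is the simplicial complex of subwords $\mathcal Q\smallsetminus\mathcal P$ whose complement $\mathcal P$ contains a reduced word for $\pi$; $\Delta(\mathcal Q_{0,n},w)$ is the pipe dream complex, and $P\mapsto \mathcal Q_{0,n}\smallsetminus\mathrm{word}(P)$ is a bijection from $\mathrm{PD}(w)$ to its interior faces. The Demazure product $\delta(\mathcal Q)$ multiplies the letters left to right, omitting any letter that would decrease length. For words $\mathcal Q,\mathcal S$, the slide complex $\widetilde\Delta(\mathcal Q,\mathcal S)$ is the simplicial complex of subwords $\mathcal Q\smallsetminus\mathcal P$ whose complement $\mathcal P$ contains $\mathcal S$ as a subword; $\widetilde\delta(\mathcal Q)$ is obtained from $\mathcal Q$ by replacing each maximal run of identical consecutive letters by a single letter. When $\widetilde\delta(\mathcal S)=\mathcal S$, the interior faces of $\widetilde\Delta(\mathcal Q,\mathcal S)$ are those $\mathcal Q\smallsetminus\mathcal P$ with $\widetilde\delta(\mathcal P)=\mathcal S$, and $\mathrm{int}\,\Delta(\mathcal Q,w)=\bigsqcup_{\widetilde\delta(\mathcal S)=\mathcal S,\ \delta(\mathcal S)=w}\mathrm{int}\,\widetilde\Delta(\mathcal Q,\mathcal S)$.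 The slide complex corresponding to the glide orbit of $Q\in\mathrm{QPD}(w)$ is $\widetilde\Delta(\mathcal Q_{0,n},\mathrm{word}(Q))$. -}

module Defs where

open import Data.Nat using (ℕ; zero; suc; _+_; _∸_; _≤_; _<_; _<ᵇ_; _≤ᵇ_)
open import Data.Bool using (Bool; true; false; if_then_else_; _∧_; not)
open import Data.List using (List; []; _∷_; map; foldl; concatMap; reverse; upTo; filterᵇ)
open import Data.Vec using (Vec; tabulate) renaming ([] to []ᵥ; _∷_ to _∷ᵥ_)
import Data.Vec as Vec
open import Data.Fin using (toℕ)
open import Data.Maybe using (Maybe; just; nothing)
import Data.Maybe as Maybe
open import Data.Product using (Σ; ∃; _×_; _,_; proj₁; proj₂)
open import Relation.Binary.PropositionalEquality using (_≡_)
open import Relation.Nullary using (yes; no)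
open import Relation.Binary.Construct.Closure.ReflexiveTransitive using (Star)

-- Conventions: rows and columns are 0-indexed. Cell (i , j) (0-indexed)
-- is cell (i+1 , j+1) of the paper.  Strictly above the antidiagonal
-- means  i + j + 2 ≤ n.  A letter  k : ℕ  stands for s_k (1 ≤ k ≤ n-1),
-- which swaps the 0-indexed positions k-1 and k.

-- safe ℕ-indexed access/update of vectors (out of range: default / no-op)
getℕ : ∀ {a} {A : Set a} {m} → A → Vec A m → ℕ → A
getℕ d []ᵥ _ = d
getℕ d (x ∷ᵥ xs) zero = x
getℕ d (x ∷ᵥ xs) (suc k) = getℕ d xs k

modℕ : ∀ {a} {A : Set a} {m} → (A → A) → Vec A m → ℕ → Vec A m
modℕ f []ᵥ _ = []ᵥ
modℕ f (x ∷ᵥ xs) zero = f x ∷ᵥ xs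
modℕ f (x ∷ᵥ xs) (suc k) = x ∷ᵥ modℕ f xs k

-- An n × n grid; true = cross, false = elbow.
Diagram : ℕ → Set
Diagram n = Vec (Vec Bool n) n

row : ∀ {n} → Diagram n → ℕ → Vec Bool n
row {n} D i = getℕ (Vec.replicate n false) D i

at : ∀ {n} → Diagram n → ℕ → ℕ → Bool
at D i j = getℕ false (row D i) j

setCell : ∀ {n} → Diagram n → ℕ → ℕ → Bool → Diagram n
setCell D i j b = modℕ (λ r → modℕ (λ _ → b) r j) D i

inStaircase : ℕ → ℕ → ℕ → Bool
inStaircase n i j = suc (suc (i + j)) ≤ᵇ n

-- all crosses strictly above the antidiagonal; this is what it means to be a
-- pipe dream, and equally what it means to be a subset of the positions of
-- the word Q_{0,n} (whose positions are exactly these cells)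
AboveAntidiagonal : ∀ {n} → Diagram n → Set
AboveAntidiagonal {n} D = ∀ i j → at D i j ≡ true → suc (suc (i + j)) ≤ n

IsPipeDream : ∀ {n} → Diagram n → Set
IsPipeDream = AboveAntidiagonal

-- the positions of Q_{0,n} in order: rows top to bottom, each right to left
cellsQ : ℕ → List (ℕ × ℕ)
cellsQ n = concatMap (λ i → map (λ j → i , j) (reverse (upTo (n ∸ suc i)))) (upTo n)

letter : ℕ × ℕ → ℕ
letter (i , j) = suc (i + j)

word : ∀ {n} → Diagram n → List ℕ
word {n} D = map letter (filterᵇ (λ c → at D (proj₁ c) (proj₂ c)) (cellsQ n))

-- permutations in one-line notation (values 0..n-1)

swapAt : ℕ → List ℕ → List ℕ
swapAt zero (a ∷ b ∷ xs) = b ∷ a ∷ xs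
swapAt (suc m) (x ∷ xs) = x ∷ swapAt m xs
swapAt _ xs = xs

ascentAt : ℕ → List ℕ → Bool
ascentAt zero (a ∷ b ∷ _) = a <ᵇ b
ascentAt (suc m) (_ ∷ xs) = ascentAt m xs
ascentAt _ _ = false

idPerm : ℕ → List ℕ
idPerm n = upTo n

mulS : List ℕ → ℕ → List ℕ
mulS u k = swapAt (k ∸ 1) u

prodWord : ℕ → List ℕ → List ℕ
prodWord n ws = foldl mulS (idPerm n) ws

demazure : ℕ → List ℕ → List ℕ
demazure n ws = foldl (λ u k → if ascentAt (k ∸ 1) u then mulS u k else u) (idPerm n) ws

-- δ̃ : collapse maximal runs of equal consecutive letters
-- collapse′ x xs : δ̃ of the word x ∷ xs
collapse′ : ℕ → List ℕ → List ℕ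
collapse′ x [] = x ∷ []
collapse′ x (y ∷ xs) with x Data.Nat.≟ y
... | yes _ = collapse′ y xs
... | no _ = x ∷ collapse′ y xs

collapse : List ℕ → List ℕ
collapse [] = []
collapse (x ∷ xs) = collapse′ x xs

-- Crosses are read in the order of Q_{0,n}; u is the
-- permutation formed by the crosses kept so far.  The two strands meeting at
-- a cross with letter s_k have already crossed iff u has a descent at k;
-- such a repeated crossing is replaced by an elbow.

reductStep : ∀ {n} → Diagram n → List ℕ × Diagram n → ℕ × ℕ → List ℕ × Diagram n
reductStep D (u , E) (i , j) =
  if at D i j
  then (if ascentAt (i + j) u then (mulS u (suc (i + j)) , E) else (u , setCell E i j false))
  else (u , E)

reduct : ∀ {n} → Diagram n → Diagram n
reduct {n} D = proj₂ (foldl (reductStep D) (idPerm n , D) (cellsQ n))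

shape : ∀ {n} → Diagram n → List ℕ
shape {n} D = prodWord n (word (reduct D))

leftmost : ∀ {m} → Vec Bool m → Maybe ℕ
leftmost []ᵥ = nothing
leftmost (true ∷ᵥ _) = just zero
leftmost (false ∷ᵥ xs) = Maybe.map suc (leftmost xs)

rightmost : ∀ {m} → Vec Bool m → Maybe ℕ
rightmost []ᵥ = nothing
rightmost (b ∷ᵥ xs) with rightmost xs
... | just r = just (suc r)
... | nothing = if b then just zero else nothing

strictlyRightOf : ℕ → Maybe ℕ → Bool
strictlyRightOf j nothing = true
strictlyRightOf j (just r) = r <ᵇ j

-- S_i (0-indexed row i, acting on rows i and i+1)
slide : ∀ {n} → ℕ → Diagram n → Diagram n
slide i D with leftmost (row D i)
... | nothing = D
... | just zero = D
... | just (suc j′) =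
  if strictlyRightOf (suc j′) (rightmost (row D (suc i)))
  then setCell (setCell D i (suc j′) false) (suc i) j′ true
  else D

-- one application of some S_i, 1 ≤ i ≤ n-1 in the paper's indexing
SlideStep : ∀ {n} → Diagram n → Diagram n → Set
SlideStep {n} A B = ∃ λ i → suc i < n × slide i A ≡ B

QuasiYamanouchi : ∀ {n} → Diagram n → Set
QuasiYamanouchi {n} D = ∀ i → suc i < n → slide i D ≡ D

-- dst(P) ≡ Q : Q is reached from P by slide moves and is quasi-Yamanouchi
-- (well defined by the paper, so this relation is the graph of dst)
Dst : ∀ {n} → Diagram n → Diagram n → Set
Dst P Q = Star SlideStep P Q × QuasiYamanouchi Q

InPD : ∀ {n} → List ℕ → Diagram n → Set
InPD w P = IsPipeDream P × shape P ≡ w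

InQPD : ∀ {n} → List ℕ → Diagram n → Set
InQPD w Q = InPD w Q × QuasiYamanouchi Q

-- faces: a face Q_{0,n} ∖ 𝒫 is a subset of positions of Q_{0,n}, i.e. an
-- above-antidiagonal diagram.

complementQ : ∀ {n} → Diagram n → Diagram n
complementQ {n} D = tabulate λ i → tabulate λ j →
  inStaircase n (toℕ i) (toℕ j) ∧ not (at D (toℕ i) (toℕ j))

faceOf : ∀ {n} → Diagram n → Diagram n
faceOf = complementQ

-- interior faces of the slide complex Δ̃(Q_{0,n}, 𝒮): faces Q_{0,n} ∖ 𝒫
-- with δ̃(𝒫) = 𝒮
InteriorSlide : ∀ {n} → List ℕ → Diagram n → Set
InteriorSlide S F = AboveAntidiagonal F × collapse (word (complementQ F)) ≡ S

module Submission where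

-- A slide move S_i takes the leftmost cross of row i, whose letter a is the last letter read in
-- row i, to the cell diagonally below-left; that cell carries the same letter a and becomes the
-- first cross read in row i + 1.  So word(P) is unchanged, or, when the cell already held a cross,
-- one of two adjacent copies of a disappears: δ̃(word P) is constant along glide orbits.  The shape
-- is the Demazure product of word(P), which ignores repeated adjacent letters, so it is constant
-- too, and dst exists because slides decrease Σᵢ (n − i) · #(crosses in row i).  In a
-- quasi-Yamanouchi Q every nonempty row is read as a maximal strictly decreasing run of word(Q)
-- whose least letter is in column 1 or lies below a letter of the next row; hence word(Q) has no
-- repeated adjacent letters, δ̃(word Q) = word Q, and the rows of Q can be read back off word(Q).
-- Finally P ↦ Q_{0,n} ∖ word(P) is complementation above the antidiagonal, an involution.

open import Defs
open import Data.Bool using (Bool; true; false; _∧_; not; T; if_then_else_)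
open import Data.Bool.Properties using (T-≡; not-involutive; ⇔→≡)
import Data.Bool.Properties as Bool
open import Data.Fin using (Fin; fromℕ<; toℕ)
import Data.Fin as Fin
open import Data.Fin.Properties using (toℕ-fromℕ<)
open import Data.List using (List; []; _∷_; _++_; [_]; map; foldl; filterᵇ; concatMap; applyUpTo; upTo; downFrom; length)
open import Data.List.Extrema.Nat using (min; argmin-all; min≤⊤; min≤xs)
open import Data.List.Membership.Propositional using (_∈_; _∉_)
open import Data.List.Membership.Propositional.Properties using (∈-map⁺; ∈-map⁻; ∈-filter⁺; ∈-filter⁻; ∈-downFrom⁺)
open import Data.List.Properties
  using (filter-none; filter-++; map-++; ++-assoc; length-++; ≡-dec; concatMap-cong; reverse-upTo; ∷-injective; ++-cancelˡ; ++-conicalˡ)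
open import Data.List.Relation.Binary.Disjoint.Propositional using (Disjoint)
open import Data.List.Relation.Binary.Permutation.Propositional using (_↭_)
open import Data.List.Relation.Unary.All using (All; []; _∷_)
import Data.List.Relation.Unary.All as All
open import Data.List.Relation.Unary.All.Properties using (applyDownFrom⁺₁; map⁺; All¬⇒¬Any) renaming (++⁺ to All-++⁺)
open import Data.List.Relation.Unary.AllPairs using (AllPairs; []; _∷_)
import Data.List.Relation.Unary.AllPairs.Properties as AllPairs
open import Data.List.Relation.Unary.Any using (here; there)
open import Data.List.Relation.Unary.Linked using (Linked; []; [-]; _∷_)
open import Data.List.Relation.Unary.Unique.Propositional using (Unique)
import Data.List.Relation.Unary.Unique.Propositional.Properties as Unique
open import Data.Maybe using (just; nothing)
import Data.Maybe as Maybe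
open import Data.Nat using (ℕ; zero; suc; _+_; _∸_; _*_; _≤_; _<_; _>_; z≤n; s≤s; s≤s⁻¹; z<s; _<ᵇ_)
open import Data.Nat.Induction using (<-wellFounded)
open import Data.Nat.ListAction using (sum)
open import Data.Nat.ListAction.Properties using (sum-++)
open import Data.Nat.Properties
open import Data.Nat.Tactic.RingSolver using (solve-∀)
open import Data.Product using (Σ; ∃; _×_; _,_; proj₁; proj₂; uncurry)
import Data.Product as Product
open import Data.Product.Properties using () renaming (≡-dec to ×-≡-dec)
open import Data.Sum using (_⊎_; inj₁; inj₂)
import Data.Sum as Sum
open import Data.Unit using (⊤)
open import Data.Vec using (Vec; tabulate) renaming ([] to []ᵥ; _∷_ to _∷ᵥ_)
import Data.Vec as Vec
import Data.Vec.Properties as Vec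
open import Function using (id; _∘_; case_of_)
open import Function.Bundles using (Equivalence; mk⇔)
open import Induction.WellFounded using (Acc; acc)
open import Relation.Binary.Construct.Closure.ReflexiveTransitive using (Star; ε; _◅_)
open import Relation.Binary.PropositionalEquality hiding ([_])
open import Relation.Nullary using (Dec; yes; no; contradiction)
open import Relation.Nullary.Decidable using (T?; _×-dec_; ¬?; decidable-stable)

module _ {a} {A : Set a} (d : A) where

  getℕ-modℕ-same : ∀ {m} (f : A → A) (v : Vec A m) {k} → k < m → getℕ d (modℕ f v k) k ≡ f (getℕ d v k)
  getℕ-modℕ-same f (x ∷ᵥ v) {zero} _ = refl
  getℕ-modℕ-same f (x ∷ᵥ v) {suc k} (s≤s k<m) = getℕ-modℕ-same f v k<m

  getℕ-modℕ-other : ∀ {m} (f : A → A) (v : Vec A m) {k k′} → k ≢ k′ → getℕ d (modℕ f v k) k′ ≡ getℕ d v k′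
  getℕ-modℕ-other f []ᵥ _ = refl
  getℕ-modℕ-other f (x ∷ᵥ v) {zero} {zero} k≢k′ = contradiction refl k≢k′
  getℕ-modℕ-other f (x ∷ᵥ v) {zero} {suc k′} _ = refl
  getℕ-modℕ-other f (x ∷ᵥ v) {suc k} {zero} _ = refl
  getℕ-modℕ-other f (x ∷ᵥ v) {suc k} {suc k′} k≢k′ = getℕ-modℕ-other f v (k≢k′ ∘ cong suc)

  getℕ-outOfRange : ∀ {m} (v : Vec A m) {k} → m ≤ k → getℕ d v k ≡ d
  getℕ-outOfRange []ᵥ _ = refl
  getℕ-outOfRange (x ∷ᵥ v) {suc k} (s≤s m≤k) = getℕ-outOfRange v m≤k

  getℕ-replicate : ∀ m k → getℕ d (Vec.replicate m d) k ≡ d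
  getℕ-replicate zero k = refl
  getℕ-replicate (suc m) zero = refl
  getℕ-replicate (suc m) (suc k) = getℕ-replicate m k

  getℕ-tabulate : ∀ {m} (f : Fin m → A) {k} (k<m : k < m) → getℕ d (tabulate f) k ≡ f (fromℕ< k<m)
  getℕ-tabulate {suc m} f {zero} _ = refl
  getℕ-tabulate {suc m} f {suc k} (s≤s k<m) = getℕ-tabulate (f ∘ Fin.suc) k<m

  getℕ-ext : ∀ {m} (u v : Vec A m) → (∀ {k} → k < m → getℕ d u k ≡ getℕ d v k) → u ≡ v
  getℕ-ext []ᵥ []ᵥ _ = refl
  getℕ-ext (x ∷ᵥ u) (y ∷ᵥ v) u≗v = cong₂ _∷ᵥ_ (u≗v (s≤s z≤n)) (getℕ-ext u v (u≗v ∘ s≤s))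

module _ {n : ℕ} where

  private
    emptyRow : Vec Bool n
    emptyRow = Vec.replicate n false

  at-setCell-same : (D : Diagram n) {i j : ℕ} (b : Bool) → i < n → j < n → at (setCell D i j b) i j ≡ b
  at-setCell-same D {i} {j} b i<n j<n
    rewrite getℕ-modℕ-same emptyRow (λ r → modℕ (λ _ → b) r j) D i<n
    = getℕ-modℕ-same false (λ _ → b) (row D i) j<n

  at-setCell-other : (D : Diagram n) {i j i′ j′ : ℕ} (b : Bool) → (i′ , j′) ≢ (i , j) →
                     at (setCell D i j b) i′ j′ ≡ at D i′ j′
  at-setCell-other D {i} {j} {i′} {j′} b c′≢c with i ≟ i′
  ... | no i≢i′ rewrite getℕ-modℕ-other emptyRow (λ r → modℕ (λ _ → b) r j) D i≢i′ = refl
  ... | yes refl with i <? n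
  ...   | yes i<n rewrite getℕ-modℕ-same emptyRow (λ r → modℕ (λ _ → b) r j) D i<n
    = getℕ-modℕ-other false (λ _ → b) (row D i) (λ j≡j′ → c′≢c (cong (i ,_) (sym j≡j′)))
  ...   | no i≮n rewrite getℕ-outOfRange emptyRow (modℕ (λ r → modℕ (λ _ → b) r j) D i) (≮⇒≥ i≮n)
                       | getℕ-outOfRange emptyRow D (≮⇒≥ i≮n)
                       | getℕ-replicate false n j′ = refl

  at-outside : (D : Diagram n) {i j : ℕ} → n ≤ i ⊎ n ≤ j → at D i j ≡ false
  at-outside D {i} {j} (inj₁ n≤i) rewrite getℕ-outOfRange emptyRow D n≤i = getℕ-replicate false n j
  at-outside D {i} (inj₂ n≤j) = getℕ-outOfRange false (row D i) n≤j

  cross⇒inGrid : (D : Diagram n) {i j : ℕ} → at D i j ≡ true → i < n × j < n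
  cross⇒inGrid D {i} {j} cross with i <? n | j <? n
  ... | yes i<n | yes j<n = i<n , j<n
  ... | no i≮n | _ = contradiction (trans (sym cross) (at-outside D (inj₁ (≮⇒≥ i≮n)))) λ ()
  ... | yes _ | no j≮n = contradiction (trans (sym cross) (at-outside D (inj₂ (≮⇒≥ j≮n)))) λ ()

  Diagram-ext : (D D′ : Diagram n) → (∀ {i j} → i < n → j < n → at D i j ≡ at D′ i j) → D ≡ D′
  Diagram-ext D D′ same = getℕ-ext emptyRow D D′ λ i<n → getℕ-ext false _ _ (same i<n)

  at-complementQ : (D : Diagram n) {i j : ℕ} → i < n → j < n →
                   at (complementQ D) i j ≡ inStaircase n i j ∧ not (at D i j)
  at-complementQ D {i} {j} i<n j<n
    rewrite getℕ-tabulate emptyRow (λ i → tabulate λ j → inStaircase n (toℕ i) (toℕ j) ∧ not (at D (toℕ i) (toℕ j))) i<n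
          | getℕ-tabulate false (λ j → inStaircase n (toℕ (fromℕ< i<n)) (toℕ j) ∧ not (at D (toℕ (fromℕ< i<n)) (toℕ j))) j<n
          | toℕ-fromℕ< i<n | toℕ-fromℕ< j<n = refl

  inStaircase⇒≤ : ∀ i j → inStaircase n i j ≡ true → suc (suc (i + j)) ≤ n
  inStaircase⇒≤ i j inQ = ≤ᵇ⇒≤ _ _ (Equivalence.from T-≡ inQ)

  ≤⇒inStaircase : ∀ i j → suc (suc (i + j)) ≤ n → inStaircase n i j ≡ true
  ≤⇒inStaircase i j le = Equivalence.to T-≡ (≤⇒≤ᵇ le)

  complementQ-aboveAntidiagonal : (D : Diagram n) → AboveAntidiagonal (complementQ D)
  complementQ-aboveAntidiagonal D i j cross with cross⇒inGrid (complementQ D) cross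
  ... | i<n , j<n rewrite at-complementQ D i<n j<n with inStaircase n i j in inQ
  ...   | true = inStaircase⇒≤ i j inQ

  complementQ-involutive : (D : Diagram n) → AboveAntidiagonal D → complementQ (complementQ D) ≡ D
  complementQ-involutive D above = Diagram-ext _ D cell
    where
    cell : ∀ {i j} → i < n → j < n → at (complementQ (complementQ D)) i j ≡ at D i j
    cell {i} {j} i<n j<n rewrite at-complementQ (complementQ D) i<n j<n | at-complementQ D i<n j<n
      with inStaircase n i j in inQ | at D i j in cross
    ... | true | b = not-involutive b
    ... | false | false = refl
    ... | false | true = contradiction (trans (sym (≤⇒inStaircase i j (above i j cross))) inQ) λ ()

crossAt : ∀ {n} → Diagram n → ℕ × ℕ → Bool
crossAt D (i , j) = at D i j

_≟ᴰ_ : ∀ {n} (D D′ : Diagram n) → Dec (D ≡ D′)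
_≟ᴰ_ = Vec.≡-dec (Vec.≡-dec Bool._≟_)

_≟ᶜ_ : (c c′ : ℕ × ℕ) → Dec (c ≡ c′)
_≟ᶜ_ = ×-≡-dec _≟_ _≟_

rowsFrom : ∀ {a} {A : Set a} → (ℕ → List A) → ℕ → ℕ → List A
rowsFrom R i zero = []
rowsFrom R i (suc k) = R i ++ rowsFrom R (suc i) k

module _ {a} {A : Set a} where

  rowsFrom-shift : (R : ℕ → List A) (i k : ℕ) → rowsFrom (R ∘ suc) i k ≡ rowsFrom R (suc i) k
  rowsFrom-shift R i zero = refl
  rowsFrom-shift R i (suc k) = cong (R (suc i) ++_) (rowsFrom-shift R (suc i) k)

  concatMap-applyUpTo : ∀ {b} {B : Set b} (R : B → List A) (f : ℕ → B) k →
                        concatMap R (applyUpTo f k) ≡ rowsFrom (R ∘ f) 0 k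
  concatMap-applyUpTo R f zero = refl
  concatMap-applyUpTo R f (suc k) =
    cong (R (f 0) ++_) (trans (concatMap-applyUpTo R (f ∘ suc) k) (rowsFrom-shift (R ∘ f) 0 k))

  map-filterᵇ-rowsFrom : ∀ {b} {B : Set b} (f : A → B) (p : A → Bool) (R : ℕ → List A) i k →
    map f (filterᵇ p (rowsFrom R i k)) ≡ rowsFrom (map f ∘ filterᵇ p ∘ R) i k
  map-filterᵇ-rowsFrom f p R i zero = refl
  map-filterᵇ-rowsFrom f p R i (suc k) = begin
    map f (filterᵇ p (R i ++ rowsFrom R (suc i) k))
      ≡⟨ cong (map f) (filter-++ (T? ∘ p) (R i) _) ⟩
    map f (filterᵇ p (R i) ++ filterᵇ p (rowsFrom R (suc i) k))
      ≡⟨ map-++ f (filterᵇ p (R i)) _ ⟩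
    map f (filterᵇ p (R i)) ++ map f (filterᵇ p (rowsFrom R (suc i) k))
      ≡⟨ cong (map f (filterᵇ p (R i)) ++_) (map-filterᵇ-rowsFrom f p R (suc i) k) ⟩
    rowsFrom (map f ∘ filterᵇ p ∘ R) i (suc k) ∎
    where open ≡-Reasoning

  rowsFrom-cong : ∀ {R R′ : ℕ → List A} j k → (∀ {m} → j ≤ m → m < j + k → R m ≡ R′ m) →
                  rowsFrom R j k ≡ rowsFrom R′ j k
  rowsFrom-cong j zero _ = refl
  rowsFrom-cong j (suc k) R≗R′ =
    cong₂ _++_ (R≗R′ ≤-refl (m<m+n j z<s))
               (rowsFrom-cong (suc j) k λ {m} j<m m<j+k → R≗R′ (<⇒≤ j<m) (subst (m <_) (sym (+-suc j k)) m<j+k))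

  rowsFrom-+ : ∀ (R : ℕ → List A) j k l → rowsFrom R j (k + l) ≡ rowsFrom R j k ++ rowsFrom R (j + k) l
  rowsFrom-+ R j zero l = cong (λ j → rowsFrom R j l) (sym (+-identityʳ j))
  rowsFrom-+ R j (suc k) l = begin
    R j ++ rowsFrom R (suc j) (k + l)                       ≡⟨ cong (R j ++_) (rowsFrom-+ R (suc j) k l) ⟩
    R j ++ (rowsFrom R (suc j) k ++ rowsFrom R (suc j + k) l) ≡⟨ sym (++-assoc (R j) _ _) ⟩
    rowsFrom R j (suc k) ++ rowsFrom R (suc j + k) l        ≡⟨ cong (λ j′ → rowsFrom R j (suc k) ++ rowsFrom R j′ l) (sym (+-suc j k)) ⟩
    rowsFrom R j (suc k) ++ rowsFrom R (j + suc k) l ∎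
    where open ≡-Reasoning

rowCells : ℕ → ℕ → List (ℕ × ℕ)
rowCells n i = map (i ,_) (downFrom (n ∸ suc i))

cellsQ-concatMap : ∀ n → cellsQ n ≡ concatMap (rowCells n) (upTo n)
cellsQ-concatMap n = concatMap-cong (λ i → cong (map (i ,_)) (reverse-upTo (n ∸ suc i))) (upTo n)

cellsQ-rowsFrom : ∀ n → cellsQ n ≡ rowsFrom (rowCells n) 0 n
cellsQ-rowsFrom n = trans (cellsQ-concatMap n) (concatMap-applyUpTo (rowCells n) id n)

cellsQ-unique : ∀ n → Unique (cellsQ n)
cellsQ-unique n = subst Unique (sym (cellsQ-concatMap n))
  (Unique.concat⁺ (map⁺ (All.tabulate λ {i} _ → Unique.map⁺ (cong proj₂) (Unique.downFrom⁺ (n ∸ suc i))))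
                  (AllPairs.map⁺ (AllPairs.applyUpTo⁺₁ id n disjoint)))
  where
  disjoint : ∀ {i j} → i < j → j < n → Disjoint (rowCells n i) (rowCells n j)
  disjoint i<j _ (c∈i , c∈j) with _ , _ , refl ← ∈-map⁻ _ c∈i | _ , _ , eq ← ∈-map⁻ _ c∈j = <⇒≢ i<j (cong proj₁ eq)

rowWord : ∀ {n} → Diagram n → ℕ → List ℕ
rowWord {n} D i = map (λ j → suc (i + j)) (filterᵇ (at D i) (downFrom (n ∸ suc i)))

letters-row : ∀ {n} (D : Diagram n) i (L : List ℕ) →
  map letter (filterᵇ (crossAt D) (map (i ,_) L)) ≡ map (λ j → suc (i + j)) (filterᵇ (at D i) L)
letters-row D i [] = refl
letters-row D i (j ∷ L) with at D i j
... | true = cong (suc (i + j) ∷_) (letters-row D i L)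
... | false = letters-row D i L

word-rowsFrom : ∀ {n} (D : Diagram n) → word D ≡ rowsFrom (rowWord D) 0 n
word-rowsFrom {n} D = begin
  map letter (filterᵇ (crossAt D) (cellsQ n))                  ≡⟨ cong (map letter ∘ filterᵇ (crossAt D)) (cellsQ-rowsFrom n) ⟩
  map letter (filterᵇ (crossAt D) (rowsFrom (rowCells n) 0 n)) ≡⟨ map-filterᵇ-rowsFrom letter (crossAt D) (rowCells n) 0 n ⟩
  rowsFrom (map letter ∘ filterᵇ (crossAt D) ∘ rowCells n) 0 n ≡⟨ rowsFrom-cong 0 n (λ {i} _ _ → letters-row D i (downFrom (n ∸ suc i))) ⟩
  rowsFrom (rowWord D) 0 n ∎
  where open ≡-Reasoning

inStaircase⇒<∸suc : ∀ n i j → suc (suc (i + j)) ≤ n → j < n ∸ suc i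
inStaircase⇒<∸suc (suc n) zero j (s≤s le) = le
inStaircase⇒<∸suc (suc n) (suc i) j (s≤s le) = inStaircase⇒<∸suc n i j le

module _ {n : ℕ} (D : Diagram n) where

  ∈-rowWord⁻ : ∀ {i x} → x ∈ rowWord D i → ∃ λ j → at D i j ≡ true × x ≡ suc (i + j)
  ∈-rowWord⁻ {i} x∈ with ∈-map⁻ (λ j → suc (i + j)) x∈
  ... | j , j∈ , refl = j , Equivalence.to T-≡ (proj₂ (∈-filter⁻ (T? ∘ at D i) {xs = downFrom (n ∸ suc i)} j∈)) , refl

  ∈-rowWord⁺ : ∀ {i j} → suc (suc (i + j)) ≤ n → at D i j ≡ true → suc (i + j) ∈ rowWord D i
  ∈-rowWord⁺ {i} {j} le cross =
    ∈-map⁺ (λ j → suc (i + j))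
           (∈-filter⁺ (T? ∘ at D i) (∈-downFrom⁺ (inStaircase⇒<∸suc n i j le)) (Equivalence.from T-≡ cross))

  rowWord-descending : ∀ i → AllPairs _>_ (rowWord D i)
  rowWord-descending i = AllPairs.map⁺ (AllPairs.filter⁺ (T? ∘ at D i)
    (AllPairs.applyDownFrom⁺₁ id (n ∸ suc i) λ j<k _ → s≤s (+-monoʳ-< i j<k)))

-- Reduct, Demazure product and δ̃

demazureStep : List ℕ → ℕ → List ℕ
demazureStep u k = if ascentAt (k ∸ 1) u then mulS u k else u

module _ {n : ℕ} (D : Diagram n) where

  reduction : List ℕ → Diagram n → List (ℕ × ℕ) → List ℕ × Diagram n
  reduction u E L = foldl (reductStep D) (u , E) L

  reduction-permutation : ∀ u E L → proj₁ (reduction u E L) ≡ foldl demazureStep u (map letter (filterᵇ (crossAt D) L))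
  reduction-permutation u E [] = refl
  reduction-permutation u E ((i , j) ∷ L) with at D i j
  ... | false = reduction-permutation u E L
  ... | true with ascentAt (i + j) u
  ...   | true = reduction-permutation (mulS u (suc (i + j))) E L
  ...   | false = reduction-permutation u (setCell E i j false) L

  reduction-outside : ∀ u E L {c} → c ∉ L → crossAt (proj₂ (reduction u E L)) c ≡ crossAt E c
  reduction-outside u E [] _ = refl
  reduction-outside u E ((i , j) ∷ L) {c} c∉ with at D i j
  ... | false = reduction-outside u E L (c∉ ∘ there)
  ... | true with ascentAt (i + j) u
  ...   | true = reduction-outside (mulS u (suc (i + j))) E L (c∉ ∘ there)
  ...   | false = trans (reduction-outside u (setCell E i j false) L (c∉ ∘ there)) (at-setCell-other E false (c∉ ∘ here))

  reduction-word : ∀ u E L → Unique L → (∀ {c} → c ∈ L → crossAt E c ≡ crossAt D c) →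
                   foldl mulS u (map letter (filterᵇ (crossAt (proj₂ (reduction u E L))) L)) ≡ proj₁ (reduction u E L)
  reduction-word u E [] _ _ = refl
  reduction-word u E ((i , j) ∷ L) (c≢L ∷ unique) E≗D with at D i j in cross
  ... | false rewrite reduction-outside u E L (All¬⇒¬Any c≢L) | E≗D (here refl) | cross =
    reduction-word u E L unique (E≗D ∘ there)
  ... | true with ascentAt (i + j) u
  ...   | true rewrite reduction-outside (mulS u (suc (i + j))) E L (All¬⇒¬Any c≢L) | E≗D (here refl) | cross =
    reduction-word (mulS u (suc (i + j))) E L unique (E≗D ∘ there)
  ...   | false rewrite reduction-outside u (setCell E i j false) L (All¬⇒¬Any c≢L)
                    | uncurry (at-setCell-same E false) (cross⇒inGrid D cross) =
    reduction-word u (setCell E i j false) L unique λ {(i′ , j′)} c∈ →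
      trans (at-setCell-other E false (≢-sym (All.lookup c≢L c∈))) (E≗D (there c∈))

shape≡demazure : ∀ {n} (D : Diagram n) → shape D ≡ demazure n (word D)
shape≡demazure {n} D =
  trans (reduction-word D (idPerm n) D (cellsQ n) (cellsQ-unique n) (λ _ → refl)) (reduction-permutation D (idPerm n) D (cellsQ n))

ascentAt-swapAt : ∀ m u → ascentAt m u ≡ true → ascentAt m (swapAt m u) ≡ false
ascentAt-swapAt zero (a ∷ b ∷ _) a<b with b <ᵇ a in b<a
... | false = refl
... | true = contradiction (<ᵇ⇒< a b (Equivalence.from T-≡ a<b)) (<⇒≯ (<ᵇ⇒< b a (Equivalence.from T-≡ b<a)))
ascentAt-swapAt (suc m) (_ ∷ u) ascent = ascentAt-swapAt m u ascent

demazureStep-idempotent : ∀ u k → demazureStep (demazureStep u k) k ≡ demazureStep u k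
demazureStep-idempotent u k with ascentAt (k ∸ 1) u in ascent
... | true rewrite ascentAt-swapAt (k ∸ 1) u ascent = refl
... | false rewrite ascent = refl

demazure-collapse : ∀ n ws → demazure n (collapse ws) ≡ demazure n ws
demazure-collapse n [] = refl
demazure-collapse n (x ∷ xs) = go (idPerm n) x xs
  where
  go : ∀ u x xs → foldl demazureStep u (collapse′ x xs) ≡ foldl demazureStep u (x ∷ xs)
  go u x [] = refl
  go u x (y ∷ xs) with x ≟ y
  ... | yes refl = trans (go u x xs) (cong (λ v → foldl demazureStep v xs) (sym (demazureStep-idempotent u x)))
  ... | no _ = go (demazureStep u x) y xs

shape-cong-collapse : ∀ {n} (D D′ : Diagram n) → collapse (word D) ≡ collapse (word D′) → shape D ≡ shape D′
shape-cong-collapse {n} D D′ collapse≡ = begin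
  shape D                         ≡⟨ shape≡demazure D ⟩
  demazure n (word D)             ≡⟨ demazure-collapse n (word D) ⟨
  demazure n (collapse (word D))  ≡⟨ cong (demazure n) collapse≡ ⟩
  demazure n (collapse (word D′)) ≡⟨ demazure-collapse n (word D′) ⟩
  demazure n (word D′)            ≡⟨ shape≡demazure D′ ⟨
  shape D′ ∎
  where open ≡-Reasoning

collapse-noRepeat : ∀ {xs} → Linked _≢_ xs → collapse xs ≡ xs
collapse-noRepeat [] = refl
collapse-noRepeat {x ∷ xs} xs! = go xs!
  where
  go : ∀ {x xs} → Linked _≢_ (x ∷ xs) → collapse′ x xs ≡ x ∷ xs
  go [-] = refl
  go {x} {y ∷ _} (x≢y ∷ xs!) with x ≟ y
  ... | yes x≡y = contradiction x≡y x≢y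
  ... | no _ = cong (x ∷_) (go xs!)

collapse′-repeat : ∀ a B → collapse′ a (a ∷ B) ≡ collapse′ a B
collapse′-repeat a B with a ≟ a
... | yes _ = refl
... | no a≢a = contradiction refl a≢a

collapse-++-repeat : ∀ A a B → collapse (A ++ a ∷ a ∷ B) ≡ collapse (A ++ a ∷ B)
collapse-++-repeat [] a B = collapse′-repeat a B
collapse-++-repeat (x ∷ A) a B = go x A
  where
  go : ∀ x A → collapse′ x (A ++ a ∷ a ∷ B) ≡ collapse′ x (A ++ a ∷ B)
  go x [] with x ≟ a
  ... | yes refl = collapse′-repeat x B
  ... | no _ = cong (x ∷_) (collapse′-repeat a B)
  go x (y ∷ A) with x ≟ y
  ... | yes _ = go y A
  ... | no _ = cong (x ∷_) (go y A)

-- Slide moves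

leftmost-just⁻ : ∀ {m} (v : Vec Bool m) {l} → leftmost v ≡ just l →
                 getℕ false v l ≡ true × (∀ {j} → j < l → getℕ false v j ≡ false)
leftmost-just⁻ (true ∷ᵥ v) refl = refl , λ ()
leftmost-just⁻ (false ∷ᵥ v) eq with leftmost v in l
leftmost-just⁻ (false ∷ᵥ v) refl | just _ with cross , before ← leftmost-just⁻ v l =
  cross , λ { {zero} _ → refl ; {suc j} (s≤s j<l) → before j<l }

leftmost-just⁺ : ∀ {m} (v : Vec Bool m) {l} → getℕ false v l ≡ true → (∀ {j} → j < l → getℕ false v j ≡ false) →
                 leftmost v ≡ just l
leftmost-just⁺ []ᵥ () _
leftmost-just⁺ (true ∷ᵥ v) {zero} _ _ = refl
leftmost-just⁺ (false ∷ᵥ v) {zero} () _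
leftmost-just⁺ (true ∷ᵥ v) {suc l} _ before = case before {0} (s≤s z≤n) of λ ()
leftmost-just⁺ (false ∷ᵥ v) {suc l} cross before = cong (Maybe.map suc) (leftmost-just⁺ v cross (before ∘ s≤s))

rightmost-nothing⁻ : ∀ {m} (v : Vec Bool m) → rightmost v ≡ nothing → ∀ j → getℕ false v j ≡ false
rightmost-just⁻ : ∀ {m} (v : Vec Bool m) {r} → rightmost v ≡ just r →
                  getℕ false v r ≡ true × (∀ {j} → r < j → getℕ false v j ≡ false)

rightmost-nothing⁻ []ᵥ _ j = refl
rightmost-nothing⁻ (b ∷ᵥ v) eq j with rightmost v in r
rightmost-nothing⁻ (false ∷ᵥ v) _ zero | nothing = refl
rightmost-nothing⁻ (false ∷ᵥ v) _ (suc j) | nothing = rightmost-nothing⁻ v r j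

rightmost-just⁻ (b ∷ᵥ v) eq with rightmost v in r
rightmost-just⁻ (b ∷ᵥ v) refl | just _ with cross , after ← rightmost-just⁻ v r = cross , λ { {suc j} (s≤s r<j) → after r<j }
rightmost-just⁻ (true ∷ᵥ v) refl | nothing = refl , λ { {suc j} _ → rightmost-nothing⁻ v r j }

rightOfRightmost⇒noCross : ∀ {m} (v : Vec Bool m) {c} → strictlyRightOf c (rightmost v) ≡ true →
                           ∀ {j} → c ≤ j → getℕ false v j ≡ false
rightOfRightmost⇒noCross v clear c≤j with rightmost v in r
... | nothing = rightmost-nothing⁻ v r _
... | just _ = proj₂ (rightmost-just⁻ v r) (<-≤-trans (<ᵇ⇒< _ _ (Equivalence.from T-≡ clear)) c≤j)

¬rightOfRightmost⇒cross : ∀ {m} (v : Vec Bool m) {c} → strictlyRightOf c (rightmost v) ≡ false →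
                          ∃ λ r → c ≤ r × getℕ false v r ≡ true
¬rightOfRightmost⇒cross v notClear with rightmost v in r
... | just r′ = r′ , ≮⇒≥ (λ r′<c → case trans (sym (Equivalence.to T-≡ (<⇒<ᵇ r′<c))) notClear of λ ()) ,
                proj₁ (rightmost-just⁻ v r)

moveCross : ∀ {n} → Diagram n → ℕ → ℕ → Diagram n
moveCross D i j = setCell (setCell D i (suc j) false) (suc i) j true

record Movable {n} (D : Diagram n) (i j : ℕ) : Set where
  field
    leftmostCross : leftmost (row D i) ≡ just (suc j)
    clearBelow : strictlyRightOf (suc j) (rightmost (row D (suc i))) ≡ true

slide-movable : ∀ {n} {D : Diagram n} {i j} → Movable D i j → slide i D ≡ moveCross D i j
slide-movable {D = D} {i} record { leftmostCross = l ; clearBelow = c } rewrite l | c = refl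

data SlideView {n} (D : Diagram n) (i : ℕ) : Set where
  fixed : slide i D ≡ D → SlideView D i
  moves : ∀ {j} → Movable D i j → SlideView D i

slideView : ∀ {n} (D : Diagram n) i → SlideView D i
slideView D i with leftmost (row D i) in l
... | nothing = fixed (fixedWhen l)
  where fixedWhen : leftmost (row D i) ≡ nothing → slide i D ≡ D
        fixedWhen l rewrite l = refl
... | just zero = fixed (fixedWhen l)
  where fixedWhen : leftmost (row D i) ≡ just zero → slide i D ≡ D
        fixedWhen l rewrite l = refl
... | just (suc j) with strictlyRightOf (suc j) (rightmost (row D (suc i))) in c
...   | true = moves record { leftmostCross = l ; clearBelow = c }
...   | false = fixed (fixedWhen l c)
  where fixedWhen : leftmost (row D i) ≡ just (suc j) → strictlyRightOf (suc j) (rightmost (row D (suc i))) ≡ false →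
                    slide i D ≡ D
        fixedWhen l c rewrite l | c = refl

module _ {n : ℕ} (D : Diagram n) {i j : ℕ} where

  at-moveCross-source : i < n → suc j < n → at (moveCross D i j) i (suc j) ≡ false
  at-moveCross-source i<n j+1<n =
    trans (at-setCell-other (setCell D i (suc j) false) {suc i} {j} true λ eq → <-irrefl (cong proj₁ eq) (n<1+n i))
          (at-setCell-same D false i<n j+1<n)

  at-moveCross-target : suc i < n → j < n → at (moveCross D i j) (suc i) j ≡ true
  at-moveCross-target = at-setCell-same (setCell D i (suc j) false) true

  at-moveCross-other : ∀ {i′ j′} → (i′ , j′) ≢ (i , suc j) → (i′ , j′) ≢ (suc i , j) →
                       at (moveCross D i j) i′ j′ ≡ at D i′ j′
  at-moveCross-other ≢source ≢target =
    trans (at-setCell-other (setCell D i (suc j) false) {suc i} {j} true ≢target) (at-setCell-other D {i} {suc j} false ≢source)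

-- Row words of quasi-Yamanouchi pipe dreams

HeadAbove : ℕ → List ℕ → Set
HeadAbove a [] = ⊤
HeadAbove a (y ∷ _) = a < y

-- MaxRun X L: X is a maximal strictly decreasing run at the front of X ++ L
data MaxRun : List ℕ → List ℕ → Set where
  [_]ʳ : ∀ {a L} → HeadAbove a L → MaxRun [ a ] L
  _∷ʳ_ : ∀ {x y X L} → x > y → MaxRun (y ∷ X) L → MaxRun (x ∷ y ∷ X) L

maxRun-unique : ∀ {X L X′ L′} → MaxRun X L → MaxRun X′ L′ → X ++ L ≡ X′ ++ L′ → X ≡ X′
maxRun-unique [ _ ]ʳ [ _ ]ʳ refl = refl
maxRun-unique {L = _ ∷ _} [ a<y ]ʳ (y<a ∷ʳ _) refl = contradiction y<a (<⇒≯ a<y)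
maxRun-unique (y<a ∷ʳ _) ([_]ʳ {L = _ ∷ _} a<y) refl = contradiction y<a (<⇒≯ a<y)
maxRun-unique (_ ∷ʳ r) (_ ∷ʳ r′) eq = cong₂ _∷_ (proj₁ (∷-injective eq)) (maxRun-unique r r′ (proj₂ (∷-injective eq)))

maxRun-split : ∀ {X L X′ L′} → MaxRun X L → MaxRun X′ L′ → X ++ L ≡ X′ ++ L′ → X ≡ X′ × L ≡ L′
maxRun-split r r′ eq with refl ← maxRun-unique r r′ eq = refl , ++-cancelˡ _ _ _ eq

maxRun-noRepeat : ∀ {X L} → MaxRun X L → Linked _≢_ L → Linked _≢_ (X ++ L)
maxRun-noRepeat {L = []} [ _ ]ʳ _ = [-]
maxRun-noRepeat {L = _ ∷ _} [ a<y ]ʳ L! = <⇒≢ a<y ∷ L!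
maxRun-noRepeat (x>y ∷ʳ r) L! = (≢-sym (<⇒≢ x>y)) ∷ maxRun-noRepeat r L!

all⇒headAbove : ∀ {a L} → All (a <_) L → HeadAbove a L
all⇒headAbove [] = _
all⇒headAbove (a<y ∷ _) = a<y

least : ∀ {X} → X ≢ [] → ∃ λ a → a ∈ X × All (a ≤_) X
least {[]} X≢[] = contradiction refl X≢[]
least {x ∷ X} _ = min x X , argmin-all id (here refl) (All.tabulate there) , min≤⊤ x X ∷ min≤xs x X

descending⇒maxRun : ∀ {X L} → X ≢ [] → AllPairs _>_ X → (∀ {a} → a ∈ X → All (a ≤_) X → HeadAbove a L) →
                    MaxRun X L
descending⇒maxRun {[]} X≢[] _ _ = contradiction refl X≢[]
descending⇒maxRun {x ∷ []} _ _ headAbove = [ headAbove (here refl) (≤-refl ∷ []) ]ʳ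
descending⇒maxRun {x ∷ y ∷ X} _ ((x>y ∷ _) ∷ desc) headAbove =
  x>y ∷ʳ descending⇒maxRun (λ ()) desc λ { a∈ a≤@(a≤y ∷ _) → headAbove (there a∈) (<⇒≤ (≤-<-trans a≤y x>y) ∷ a≤) }

-- leastLetter: the leftmost cross of row i is in column 1, or S_i is blocked by a cross of row
-- i + 1 to the right of the cell below-left of it.
record QuasiYamanouchiRows (n : ℕ) (R : ℕ → List ℕ) : Set where
  field
    descending : ∀ i → AllPairs _>_ (R i)
    bounded : ∀ {i x} → x ∈ R i → suc i ≤ x × x < n
    leastLetter : ∀ {i a} → suc i < n → a ∈ R i → All (a ≤_) (R i) →
                  a ≡ suc i ⊎ ∃ λ y → y ∈ R (suc i) × a < y

module _ {n : ℕ} {R : ℕ → List ℕ} (Q : QuasiYamanouchiRows n R) where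
  open QuasiYamanouchiRows Q

  nonemptyRow⇒suc<n : ∀ {i} → R i ≢ [] → suc i < n
  nonemptyRow⇒suc<n Ri≢[] with a , a∈ , _ ← least Ri≢[] = uncurry ≤-<-trans (bounded a∈)

  rowsFrom-lowerBound : ∀ j k → All (suc j ≤_) (rowsFrom R j k)
  rowsFrom-lowerBound j zero = []
  rowsFrom-lowerBound j (suc k) =
    All-++⁺ (All.tabulate (proj₁ ∘ bounded)) (All.map (≤-trans (n≤1+n (suc j))) (rowsFrom-lowerBound (suc j) k))

  headAbove-least : ∀ {i a} → a ∈ R i → All (a ≤_) (R i) → ∀ k → HeadAbove a (rowsFrom R (suc i) k)
  headAbove-least a∈ a≤ zero = _
  headAbove-least {i} {a} a∈ a≤ (suc k) with suc i <? n
  ... | no i+1≮n = all⇒headAbove (All.map (λ x≥ → <-≤-trans a<i+1 (≤-trans (n≤1+n _) x≥)) (rowsFrom-lowerBound (suc i) (suc k)))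
    where
    a<i+1 : a < suc i
    a<i+1 = <-≤-trans (proj₂ (bounded a∈)) (≮⇒≥ i+1≮n)
  ... | yes i+1<n with leastLetter i+1<n a∈ a≤
  ...   | inj₁ refl = all⇒headAbove (rowsFrom-lowerBound (suc i) (suc k))
  ...   | inj₂ (y , y∈ , a<y) with R (suc i) | descending (suc i)
  ...     | z ∷ _ | z>Z ∷ _ with y∈
  ...       | here refl = a<y
  ...       | there y∈Z = <-trans a<y (All.lookup z>Z y∈Z)

  maxRun-row : ∀ {i} → R i ≢ [] → ∀ k → MaxRun (R i) (rowsFrom R (suc i) k)
  maxRun-row {i} Ri≢[] k = descending⇒maxRun Ri≢[] (descending i) λ a∈ a≤ → headAbove-least a∈ a≤ k

  rowsFrom-noRepeat : ∀ j k → Linked _≢_ (rowsFrom R j k)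
  rowsFrom-noRepeat j zero = []
  rowsFrom-noRepeat j (suc k) with ≡-dec _≟_ (R j) []
  ... | yes Rj≡[] = subst (λ Rj → Linked _≢_ (Rj ++ rowsFrom R (suc j) k)) (sym Rj≡[]) (rowsFrom-noRepeat (suc j) k)
  ... | no Rj≢[] = maxRun-noRepeat (maxRun-row Rj≢[] k) (rowsFrom-noRepeat (suc j) k)

module _ {n : ℕ} {R R′ : ℕ → List ℕ} (Q : QuasiYamanouchiRows n R) (Q′ : QuasiYamanouchiRows n R′) where
  open QuasiYamanouchiRows

  -- The run R i would also be the run R′ j, so its least letter exceeds j > i; hence it is not
  -- in column 1 and climbs to a letter of row i + 1, and the argument repeats one row down.
  rowsFrom-noShift : ∀ {i j k} k′ → i < j → R i ≢ [] → i + k ≡ n → rowsFrom R i k ≢ rowsFrom R′ j k′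
  rowsFrom-noShift {i} {k = zero} _ _ Ri≢[] i+0≡n _ =
    <-irrefl (trans (sym (+-identityʳ i)) i+0≡n) (<-trans (n<1+n i) (nonemptyRow⇒suc<n Q Ri≢[]))
  rowsFrom-noShift {k = suc k} zero _ Ri≢[] _ eq = Ri≢[] (++-conicalˡ _ _ eq)
  rowsFrom-noShift {i} {j} {suc k} (suc k′) i<j Ri≢[] i+k≡n eq with ≡-dec _≟_ (R′ j) []
  ... | yes R′j≡[] =
    rowsFrom-noShift k′ (m<n⇒m<1+n i<j) Ri≢[] i+k≡n (trans eq (cong (_++ rowsFrom R′ (suc j) k′) R′j≡[]))
  ... | no R′j≢[] with Ri≡R′j , tails≡ ← maxRun-split (maxRun-row Q Ri≢[] k) (maxRun-row Q′ R′j≢[] k′) eq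
                  | a , a∈ , a≤ ← least Ri≢[]
                  with leastLetter Q (nonemptyRow⇒suc<n Q Ri≢[]) a∈ a≤
  ...     | inj₁ refl = <⇒≱ i<j (s≤s⁻¹ (proj₁ (bounded Q′ (subst (suc i ∈_) Ri≡R′j a∈))))
  ...     | inj₂ (_ , y∈ , _) = rowsFrom-noShift k′ (s≤s i<j) (λ e → case subst (_ ∈_) e y∈ of λ ())
                                  (trans (sym (+-suc i k)) i+k≡n) tails≡

module _ {n : ℕ} {R R′ : ℕ → List ℕ} (Q : QuasiYamanouchiRows n R) (Q′ : QuasiYamanouchiRows n R′) where

  rowsFrom-injective : ∀ {i} k → i + k ≡ n → rowsFrom R i k ≡ rowsFrom R′ i k →
                       ∀ {m} → i ≤ m → m < n → R m ≡ R′ m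
  rowsFrom-injective {i} zero i+0≡n _ i≤m m<n =
    contradiction (≤-trans (≤-reflexive (trans (sym i+0≡n) (+-identityʳ i))) i≤m) (<⇒≱ m<n)
  rowsFrom-injective {i} (suc k) i+k≡n eq {m} i≤m m<n with firstRows
    where
    tail tail′ : List ℕ
    tail = rowsFrom R (suc i) k
    tail′ = rowsFrom R′ (suc i) k
    firstRows : R i ≡ R′ i × tail ≡ tail′
    firstRows with ≡-dec _≟_ (R i) [] | ≡-dec _≟_ (R′ i) []
    ... | yes Ri≡[] | yes R′i≡[] =
      trans Ri≡[] (sym R′i≡[]) , trans (sym (cong (_++ tail) Ri≡[])) (trans eq (cong (_++ tail′) R′i≡[]))
    ... | no Ri≢[] | yes R′i≡[] =
      contradiction (trans eq (cong (_++ tail′) R′i≡[])) (rowsFrom-noShift Q Q′ k (n<1+n i) Ri≢[] i+k≡n)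
    ... | yes Ri≡[] | no R′i≢[] =
      contradiction (trans (sym eq) (cong (_++ tail) Ri≡[])) (rowsFrom-noShift Q′ Q k (n<1+n i) R′i≢[] i+k≡n)
    ... | no Ri≢[] | no R′i≢[] = maxRun-split (maxRun-row Q Ri≢[] k) (maxRun-row Q′ R′i≢[] k) eq
  ... | Ri≡R′i , tails≡ with i ≟ m
  ...   | yes refl = Ri≡R′i
  ...   | no i≢m = rowsFrom-injective k (trans (sym (+-suc i k)) i+k≡n) tails≡ (≤∧≢⇒< i≤m i≢m) m<n

quasiYamanouchiRows : ∀ {n} {D : Diagram n} → AboveAntidiagonal D → QuasiYamanouchi D → QuasiYamanouchiRows n (rowWord D)
quasiYamanouchiRows {n} {D} above qy = record
  { descending = rowWord-descending D ; bounded = bounded ; leastLetter = leastLetter }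
  where
  bounded : ∀ {i x} → x ∈ rowWord D i → suc i ≤ x × x < n
  bounded {i} x∈ with j , cross , refl ← ∈-rowWord⁻ D x∈ = s≤s (m≤m+n i j) , above i j cross

  leastLetter : ∀ {i a} → suc i < n → a ∈ rowWord D i → All (a ≤_) (rowWord D i) →
                a ≡ suc i ⊎ ∃ λ y → y ∈ rowWord D (suc i) × a < y
  leastLetter {i} i+1<n a∈ a≤ with l , cross , refl ← ∈-rowWord⁻ D a∈ = fromColumn l cross leftmostCross
    where
    leftmostCross : leftmost (row D i) ≡ just l
    leftmostCross = leftmost-just⁺ (row D i) cross noCrossBefore
      where
      noCrossBefore : ∀ {j} → j < l → at D i j ≡ false
      noCrossBefore {j} j<l with at D i j in cross′
      ... | false = refl
      ... | true =
        contradiction (+-cancelˡ-≤ i _ _ (s≤s⁻¹ (All.lookup a≤ (∈-rowWord⁺ D (above i j cross′) cross′)))) (<⇒≱ j<l)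
    fromColumn : ∀ l → at D i l ≡ true → leftmost (row D i) ≡ just l →
                 suc (i + l) ≡ suc i ⊎ ∃ λ y → y ∈ rowWord D (suc i) × suc (i + l) < y
    fromColumn zero _ _ = inj₁ (cong suc (+-identityʳ i))
    fromColumn (suc j) cross lm with strictlyRightOf (suc j) (rightmost (row D (suc i))) in clear
    ... | true =
      let movable : Movable D i j
          movable = record { leftmostCross = lm ; clearBelow = clear }
          moveCross≡D : moveCross D i j ≡ D
          moveCross≡D = trans (sym (slide-movable movable)) (qy i i+1<n)
          noCross : at D i (suc j) ≡ false
          noCross = trans (cong (λ E → at E i (suc j)) (sym moveCross≡D)) (uncurry (at-moveCross-source D) (cross⇒inGrid D cross))
      in case trans (sym cross) noCross of λ ()
    ... | false with r , j<r , cross′ ← ¬rightOfRightmost⇒cross (row D (suc i)) clear =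
      inj₂ (suc (suc i + r) , ∈-rowWord⁺ D (above (suc i) r cross′) cross′ , s≤s (s≤s (+-monoʳ-≤ i j<r)))

module _ {n : ℕ} {Q : Diagram n} (above : AboveAntidiagonal Q) (qy : QuasiYamanouchi Q) where

  quasiYamanouchi-collapse : collapse (word Q) ≡ word Q
  quasiYamanouchi-collapse rewrite word-rowsFrom Q =
    collapse-noRepeat (rowsFrom-noRepeat (quasiYamanouchiRows above qy) 0 n)

  quasiYamanouchi-word-injective : ∀ {Q′ : Diagram n} → AboveAntidiagonal Q′ → QuasiYamanouchi Q′ →
                                   word Q ≡ word Q′ → Q ≡ Q′
  quasiYamanouchi-word-injective {Q′} above′ qy′ eq = Diagram-ext Q Q′ λ {i} {j} i<n _ →
    ⇔→≡ {z = true} (mk⇔ (sameCross Q Q′ above (rows≡ i<n)) (sameCross Q′ Q above′ (sym (rows≡ i<n))))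
    where
    rows≡ : ∀ {i} → i < n → rowWord Q i ≡ rowWord Q′ i
    rows≡ = rowsFrom-injective (quasiYamanouchiRows above qy) (quasiYamanouchiRows above′ qy′) n refl
              (trans (sym (word-rowsFrom Q)) (trans eq (word-rowsFrom Q′))) z≤n
    sameCross : ∀ (D D′ : Diagram n) {i j} → AboveAntidiagonal D → rowWord D i ≡ rowWord D′ i →
                at D i j ≡ true → at D′ i j ≡ true
    sameCross D D′ {i} {j} aboveD rows≡ cross
      with j′ , cross′ , eq ← ∈-rowWord⁻ D′ (subst (_ ∈_) rows≡ (∈-rowWord⁺ D (aboveD i j cross) cross))
      rewrite +-cancelˡ-≡ i j j′ (suc-injective eq) = cross′

-- Effect of a slide on the row words

record LastLetterMovedDown (n : ℕ) (R R′ : ℕ → List ℕ) (i : ℕ) : Set where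
  field
    a : ℕ
    X Y : List ℕ
    row-i : R i ≡ X ++ [ a ]
    row-i′ : R′ i ≡ X
    row-suc-i′ : R′ (suc i) ≡ a ∷ Y
    row-suc-i : R (suc i) ≡ Y ⊎ R (suc i) ≡ a ∷ Y
    other-rows : ∀ {m} → m ≢ i → m ≢ suc i → R m ≡ R′ m
    suc-i<n : suc i < n

weight : ℕ → (ℕ → List ℕ) → ℕ
weight n R = sum (rowsFrom (λ m → [ (n ∸ m) * length (R m) ]) 0 n)

weight-step : ∀ c x x′ y y′ s → x ≡ suc x′ → y′ ≤ suc y → suc c * x′ + (c * y′ + s) < suc c * x + (c * y + s)
weight-step c x x′ y y′ s refl y′≤ = ≤-trans (s≤s (+-monoʳ-≤ (suc c * x′) (+-monoˡ-≤ s (*-monoʳ-≤ c y′≤))))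
                                              (≤-reflexive (rearrange c x′ y s))
  where
  rearrange : ∀ c x y s → suc (suc c * x + (c * suc y + s)) ≡ suc c * suc x + (c * y + s)
  rearrange = solve-∀

n∸m≡suc[n∸suc[m]] : ∀ {m n} → m < n → n ∸ m ≡ suc (n ∸ suc m)
n∸m≡suc[n∸suc[m]] {zero} {suc n} _ = refl
n∸m≡suc[n∸suc[m]] {suc m} {suc n} m<n = n∸m≡suc[n∸suc[m]] (s≤s⁻¹ m<n)

module _ {n : ℕ} {R R′ : ℕ → List ℕ} {i : ℕ} (M : LastLetterMovedDown n R R′ i) where
  open LastLetterMovedDown M

  private
    t : ℕ
    t = n ∸ suc (suc i)

    rowsFrom-split : ∀ {b} {B : Set b} (S : ℕ → List B) →
                     rowsFrom S 0 n ≡ rowsFrom S 0 i ++ (S i ++ (S (suc i) ++ rowsFrom S (suc (suc i)) t))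
    rowsFrom-split S = trans (cong (rowsFrom S 0) n≡) (rowsFrom-+ S 0 i (suc (suc t)))
      where
      n≡ : n ≡ i + suc (suc t)
      n≡ = trans (sym (m+[n∸m]≡n suc-i<n)) (sym (trans (+-suc i (suc t)) (cong suc (+-suc i t))))

    module _ {b} {B : Set b} (f : ℕ → List ℕ → List B) where
      prefix≡ : rowsFrom (λ m → f m (R m)) 0 i ≡ rowsFrom (λ m → f m (R′ m)) 0 i
      prefix≡ = rowsFrom-cong 0 i λ _ m<i → cong (f _) (other-rows (<⇒≢ m<i) (<⇒≢ (m<n⇒m<1+n m<i)))

      suffix≡ : rowsFrom (λ m → f m (R m)) (suc (suc i)) t ≡ rowsFrom (λ m → f m (R′ m)) (suc (suc i)) t
      suffix≡ = rowsFrom-cong (suc (suc i)) t λ i+2≤m _ →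
        cong (f _) (other-rows (≢-sym (<⇒≢ (<-trans (n<1+n i) i+2≤m))) (≢-sym (<⇒≢ i+2≤m)))

    P S : List ℕ
    P = rowsFrom R 0 i ++ X
    S = rowsFrom R (suc (suc i)) t

    word-R : rowsFrom R 0 n ≡ P ++ a ∷ (R (suc i) ++ S)
    word-R = begin
      rowsFrom R 0 n                                          ≡⟨ rowsFrom-split R ⟩
      rowsFrom R 0 i ++ (R i ++ (R (suc i) ++ S))              ≡⟨ cong (λ Z → rowsFrom R 0 i ++ (Z ++ (R (suc i) ++ S))) row-i ⟩
      rowsFrom R 0 i ++ ((X ++ [ a ]) ++ (R (suc i) ++ S))     ≡⟨ cong (rowsFrom R 0 i ++_) (++-assoc X [ a ] _) ⟩
      rowsFrom R 0 i ++ (X ++ a ∷ (R (suc i) ++ S))            ≡⟨ ++-assoc (rowsFrom R 0 i) X _ ⟨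
      P ++ a ∷ (R (suc i) ++ S) ∎
      where open ≡-Reasoning

    word-R′ : rowsFrom R′ 0 n ≡ P ++ a ∷ (Y ++ S)
    word-R′ = begin
      rowsFrom R′ 0 n                                          ≡⟨ rowsFrom-split R′ ⟩
      rowsFrom R′ 0 i ++ (R′ i ++ (R′ (suc i) ++ rowsFrom R′ (suc (suc i)) t))
        ≡⟨ cong₂ (λ Z W → rowsFrom R′ 0 i ++ (Z ++ W)) row-i′ (cong₂ _++_ row-suc-i′ (sym (suffix≡ λ _ L → L))) ⟩
      rowsFrom R′ 0 i ++ (X ++ a ∷ (Y ++ S))                    ≡⟨ cong (_++ (X ++ a ∷ (Y ++ S))) (sym (prefix≡ λ _ L → L)) ⟩
      rowsFrom R 0 i ++ (X ++ a ∷ (Y ++ S))                     ≡⟨ ++-assoc (rowsFrom R 0 i) X _ ⟨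
      P ++ a ∷ (Y ++ S) ∎
      where open ≡-Reasoning

  lastLetterMovedDown-collapse : collapse (rowsFrom R 0 n) ≡ collapse (rowsFrom R′ 0 n)
  lastLetterMovedDown-collapse with row-suc-i
  ... | inj₁ Ri+1≡Y = cong collapse (trans word-R (trans (cong (λ Z → P ++ a ∷ (Z ++ S)) Ri+1≡Y) (sym word-R′)))
  ... | inj₂ Ri+1≡aY = trans (cong collapse (trans word-R (cong (λ Z → P ++ a ∷ (Z ++ S)) Ri+1≡aY)))
                             (trans (collapse-++-repeat P a (Y ++ S)) (cong collapse (sym word-R′)))

  private
    rowWeight : ℕ → List ℕ → List ℕ
    rowWeight m L = [ (n ∸ m) * length L ]

    sumFrom : (ℕ → List ℕ) → ℕ → ℕ → ℕ
    sumFrom Z j k = sum (rowsFrom (λ m → rowWeight m (Z m)) j k)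

    weight-split : ∀ Z → weight n Z ≡
      sumFrom Z 0 i + ((n ∸ i) * length (Z i) + ((n ∸ suc i) * length (Z (suc i)) + sumFrom Z (suc (suc i)) t))
    weight-split Z = trans (cong sum (rowsFrom-split (λ m → rowWeight m (Z m)))) (sum-++ (rowsFrom (λ m → rowWeight m (Z m)) 0 i) _)

    length-i : length (R i) ≡ suc (length (R′ i))
    length-i rewrite row-i | row-i′ | length-++ X {[ a ]} = +-comm (length X) 1

    length-suc-i : length (R′ (suc i)) ≤ suc (length (R (suc i)))
    length-suc-i with row-suc-i
    ... | inj₁ Ri+1≡Y rewrite row-suc-i′ | Ri+1≡Y = ≤-refl
    ... | inj₂ Ri+1≡aY rewrite row-suc-i′ | Ri+1≡aY = n≤1+n _

  lastLetterMovedDown-weight : weight n R′ < weight n R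
  lastLetterMovedDown-weight = begin-strict
    weight n R′
      ≡⟨ weight-split R′ ⟩
    sumFrom R′ 0 i + ((n ∸ i) * length (R′ i) + (c * length (R′ (suc i)) + sumFrom R′ (suc (suc i)) t))
      ≡⟨ cong₂ (λ p s → p + ((n ∸ i) * length (R′ i) + (c * length (R′ (suc i)) + s)))
               (cong sum (sym (prefix≡ rowWeight))) (cong sum (sym (suffix≡ rowWeight))) ⟩
    p + ((n ∸ i) * length (R′ i) + (c * length (R′ (suc i)) + s))
      ≡⟨ cong (λ w → p + (w * length (R′ i) + (c * length (R′ (suc i)) + s))) n∸i≡ ⟩
    p + (suc c * length (R′ i) + (c * length (R′ (suc i)) + s))
      <⟨ +-monoʳ-< p (weight-step c _ _ _ _ s length-i length-suc-i) ⟩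
    p + (suc c * length (R i) + (c * length (R (suc i)) + s))
      ≡⟨ cong (λ w → p + (w * length (R i) + (c * length (R (suc i)) + s))) n∸i≡ ⟨
    sumFrom R 0 i + ((n ∸ i) * length (R i) + (c * length (R (suc i)) + sumFrom R (suc (suc i)) t))
      ≡⟨ weight-split R ⟨
    weight n R ∎
    where
    open ≤-Reasoning
    c p s : ℕ
    c = n ∸ suc i
    p = sumFrom R 0 i
    s = sumFrom R (suc (suc i)) t
    n∸i≡ : n ∸ i ≡ suc c
    n∸i≡ = n∸m≡suc[n∸suc[m]] (<-trans (n<1+n i) suc-i<n)

module _ (p : ℕ → Bool) where

  filterᵇ-downFrom-none : ∀ m → (∀ {j} → j < m → p j ≡ false) → filterᵇ p (downFrom m) ≡ []
  filterᵇ-downFrom-none m none = filter-none (T? ∘ p) (applyDownFrom⁺₁ id m λ j<m → subst T (none j<m))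

  filterᵇ-downFrom-cong : ∀ (q : ℕ → Bool) m → (∀ {j} → j < m → p j ≡ q j) →
                          filterᵇ p (downFrom m) ≡ filterᵇ q (downFrom m)
  filterᵇ-downFrom-cong q zero _ = refl
  filterᵇ-downFrom-cong q (suc m) p≗q rewrite p≗q (n<1+n m) with q m
  ... | true = cong (m ∷_) (filterᵇ-downFrom-cong q m (p≗q ∘ m<n⇒m<1+n))
  ... | false = filterᵇ-downFrom-cong q m (p≗q ∘ m<n⇒m<1+n)

  filterᵇ-downFrom-above : ∀ {l m} → l < m → (∀ {j} → l < j → p j ≡ false) →
                           filterᵇ p (downFrom m) ≡ filterᵇ p (downFrom (suc l))
  filterᵇ-downFrom-above {l} {suc m} l<m noneAbove with m ≟ l
  ... | yes refl = refl
  ... | no m≢l with l<m ← ≤∧≢⇒< (s≤s⁻¹ l<m) (≢-sym m≢l) rewrite noneAbove l<m = filterᵇ-downFrom-above l<m noneAbove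

module _ (p p′ : ℕ → Bool) {l : ℕ} (agree : ∀ {j} → j ≢ l → p′ j ≡ p j) where

  filterᵇ-downFrom-dropLeast : ∀ {m} → l < m → p l ≡ true → p′ l ≡ false → (∀ {j} → j < l → p j ≡ false) →
                               filterᵇ p (downFrom m) ≡ filterᵇ p′ (downFrom m) ++ [ l ]
  filterᵇ-downFrom-dropLeast {suc m} l<m pl p′l noneBelow with m ≟ l
  ... | yes refl rewrite pl | p′l
    | filterᵇ-downFrom-none p m noneBelow
    | filterᵇ-downFrom-none p′ m (λ j<m → trans (agree (<⇒≢ j<m)) (noneBelow j<m)) = refl
  ... | no m≢l rewrite agree m≢l with p m
  ...   | true = cong (m ∷_) (filterᵇ-downFrom-dropLeast (≤∧≢⇒< (s≤s⁻¹ l<m) (≢-sym m≢l)) pl p′l noneBelow)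
  ...   | false = filterᵇ-downFrom-dropLeast (≤∧≢⇒< (s≤s⁻¹ l<m) (≢-sym m≢l)) pl p′l noneBelow

  filterᵇ-downFrom-addGreatest : ∀ {m} → l < m → p′ l ≡ true → (∀ {j} → l < j → p j ≡ false) →
    filterᵇ p′ (downFrom m) ≡ l ∷ filterᵇ p (downFrom l) ×
    (filterᵇ p (downFrom m) ≡ filterᵇ p (downFrom l) ⊎ filterᵇ p (downFrom m) ≡ l ∷ filterᵇ p (downFrom l))
  filterᵇ-downFrom-addGreatest {m} l<m p′l noneAbove
    rewrite filterᵇ-downFrom-above p l<m noneAbove
          | filterᵇ-downFrom-above p′ l<m (λ l<j → trans (agree (≢-sym (<⇒≢ l<j))) (noneAbove l<j))
          | p′l
          | filterᵇ-downFrom-cong p′ p l (agree ∘ <⇒≢)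
    with p l
  ... | true = refl , inj₂ refl
  ... | false = refl , inj₁ refl

module _ {n : ℕ} {D : Diagram n} (above : AboveAntidiagonal D) {i j : ℕ} (movable : Movable D i j) where
  open Movable movable

  private
    D′ : Diagram n
    D′ = moveCross D i j

    source : at D i (suc j) ≡ true
    source = proj₁ (leftmost-just⁻ (row D i) leftmostCross)

    inStaircase′ : suc (suc (suc i + j)) ≤ n
    inStaircase′ = subst (λ s → suc (suc s) ≤ n) (+-suc i j) (above i (suc j) source)

    rowsDiffer : ∀ {i′ i″ j′ j″ : ℕ} → i′ ≢ i″ → (i′ , j′) ≢ (i″ , j″)
    rowsDiffer i′≢i eq = i′≢i (cong proj₁ eq)

  moveCross-aboveAntidiagonal : AboveAntidiagonal D′
  moveCross-aboveAntidiagonal m j′ cross with (m , j′) ≟ᶜ (suc i , j) | (m , j′) ≟ᶜ (i , suc j)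
  ... | yes refl | _ = inStaircase′
  ... | no ≢target | yes refl = contradiction (trans (sym cross) (uncurry (at-moveCross-source D) (cross⇒inGrid D source))) λ ()
  ... | no ≢target | no ≢source = above m j′ (trans (sym (at-moveCross-other D ≢source ≢target)) cross)

  moveCross-lastLetterMovedDown : LastLetterMovedDown n (rowWord D) (rowWord D′) i
  moveCross-lastLetterMovedDown = record
    { a = suc (i + suc j)
    ; X = rowWord D′ i
    ; Y = Y
    ; row-i = row-i
    ; row-i′ = refl
    ; row-suc-i′ = trans (cong (map g) (proj₁ addGreatest)) (cong (_∷ Y) g[j]≡a)
    ; row-suc-i = Sum.map (cong (map g)) (λ e → trans (cong (map g) e) (cong (_∷ Y) g[j]≡a)) (proj₂ addGreatest)
    ; other-rows = other-rows
    ; suc-i<n = suc-i<n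
    }
    where
    i<n : i < n
    i<n = proj₁ (cross⇒inGrid D source)
    j+1<n : suc j < n
    j+1<n = proj₂ (cross⇒inGrid D source)
    suc-i<n : suc i < n
    suc-i<n = ≤-trans (s≤s (s≤s (m≤m+n i (suc j)))) (above i (suc j) source)
    g : ℕ → ℕ
    g j′ = suc (suc i + j′)
    g[j]≡a : g j ≡ suc (i + suc j)
    g[j]≡a = cong suc (sym (+-suc i j))

    row-i : rowWord D i ≡ rowWord D′ i ++ [ suc (i + suc j) ]
    row-i = trans (cong (map (λ j′ → suc (i + j′)))
                    (filterᵇ-downFrom-dropLeast (at D i) (at D′ i) agree (inStaircase⇒<∸suc n i (suc j) (above i (suc j) source))
                      source (at-moveCross-source D i<n j+1<n) (proj₂ (leftmost-just⁻ (row D i) leftmostCross))))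
                  (map-++ (λ j′ → suc (i + j′)) _ [ suc j ])
      where
      agree : ∀ {j′} → j′ ≢ suc j → at D′ i j′ ≡ at D i j′
      agree j′≢ = at-moveCross-other D (j′≢ ∘ cong proj₂) (rowsDiffer (<⇒≢ (n<1+n i)))

    Y : List ℕ
    Y = map g (filterᵇ (at D (suc i)) (downFrom j))

    addGreatest : filterᵇ (at D′ (suc i)) (downFrom (n ∸ suc (suc i))) ≡ j ∷ filterᵇ (at D (suc i)) (downFrom j) ×
                  (filterᵇ (at D (suc i)) (downFrom (n ∸ suc (suc i))) ≡ filterᵇ (at D (suc i)) (downFrom j) ⊎
                   filterᵇ (at D (suc i)) (downFrom (n ∸ suc (suc i))) ≡ j ∷ filterᵇ (at D (suc i)) (downFrom j))
    addGreatest = filterᵇ-downFrom-addGreatest (at D (suc i)) (at D′ (suc i))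
      (λ j′≢j → at-moveCross-other D (rowsDiffer (≢-sym (<⇒≢ (n<1+n i)))) (j′≢j ∘ cong proj₂))
      (inStaircase⇒<∸suc n (suc i) j inStaircase′) (at-moveCross-target D suc-i<n (<-trans (n<1+n j) j+1<n))
      (rightOfRightmost⇒noCross (row D (suc i)) clearBelow)

    other-rows : ∀ {m} → m ≢ i → m ≢ suc i → rowWord D m ≡ rowWord D′ m
    other-rows {m} m≢i m≢i+1 = cong (map (λ j′ → suc (m + j′)))
      (filterᵇ-downFrom-cong (at D m) (at D′ m) (n ∸ suc m) λ _ →
        sym (at-moveCross-other D (rowsDiffer m≢i) (rowsDiffer m≢i+1)))

  moveCross-collapse : collapse (word D) ≡ collapse (word D′)
  moveCross-collapse rewrite word-rowsFrom D | word-rowsFrom D′ = lastLetterMovedDown-collapse moveCross-lastLetterMovedDown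

  moveCross-weight : weight n (rowWord D′) < weight n (rowWord D)
  moveCross-weight = lastLetterMovedDown-weight moveCross-lastLetterMovedDown

slide-invariant : ∀ {n} (D : Diagram n) i → AboveAntidiagonal D →
                  AboveAntidiagonal (slide i D) × collapse (word D) ≡ collapse (word (slide i D))
slide-invariant D i above with slideView D i
... | fixed slid rewrite slid = above , refl
... | moves movable rewrite slide-movable movable = moveCross-aboveAntidiagonal above movable , moveCross-collapse above movable

slides-invariant : ∀ {n} {P Q : Diagram n} → Star SlideStep P Q → AboveAntidiagonal P →
                   AboveAntidiagonal Q × collapse (word P) ≡ collapse (word Q)
slides-invariant ε above = above , refl
slides-invariant {P = P} ((i , _ , refl) ◅ slides) above with above′ , collapse≡ ← slide-invariant P i above =
  Product.map₂ (trans collapse≡) (slides-invariant slides above′)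

dst-exists : ∀ {n} (D : Diagram n) → AboveAntidiagonal D → ∃ λ Q → Dst D Q
dst-exists {n} D above = go D above (<-wellFounded (weight n (rowWord D)))
  where
  go : ∀ D → AboveAntidiagonal D → Acc _<_ (weight n (rowWord D)) → ∃ λ Q → Dst D Q
  go D above (acc smaller) with anyUpTo? (λ i → suc i <? n ×-dec ¬? (slide i D ≟ᴰ D)) n
  ... | no noMove = D , ε , λ i i+1<n →
    decidable-stable (slide i D ≟ᴰ D) λ moved → noMove (i , <-trans (n<1+n i) i+1<n , i+1<n , moved)
  ... | yes (i , _ , i+1<n , moved) with slideView D i
  ...   | fixed slid = contradiction slid moved
  ...   | moves {j} movable
    with Q , slides , qy ← go (moveCross D i j) (moveCross-aboveAntidiagonal above movable) (smaller (moveCross-weight above movable))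
    = Q , (i , i+1<n , slide-movable movable) ◅ slides , qy

-- Glide orbits and slide complexes

faceOf-injective : ∀ {n} {P P′ : Diagram n} → AboveAntidiagonal P → AboveAntidiagonal P′ →
                   faceOf P ≡ faceOf P′ → P ≡ P′
faceOf-injective {P = P} {P′} above above′ eq =
  trans (sym (complementQ-involutive P above)) (trans (cong complementQ eq) (complementQ-involutive P′ above′))

module _ {n : ℕ} {Q : Diagram n} (aboveQ : AboveAntidiagonal Q) (qyQ : QuasiYamanouchi Q) where

  glideOrbit⇒interior : ∀ {P} → AboveAntidiagonal P → Dst P Q → InteriorSlide (word Q) (faceOf P)
  glideOrbit⇒interior {P} aboveP (slides , _) = complementQ-aboveAntidiagonal P , (begin
    collapse (word (complementQ (complementQ P))) ≡⟨ cong (collapse ∘ word) (complementQ-involutive P aboveP) ⟩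
    collapse (word P)                             ≡⟨ proj₂ (slides-invariant slides aboveP) ⟩
    collapse (word Q)                             ≡⟨ quasiYamanouchi-collapse aboveQ qyQ ⟩
    word Q ∎)
    where open ≡-Reasoning

  interior⇒glideOrbit : ∀ {F} → InteriorSlide (word Q) F →
                        Σ (Diagram n) λ P → (AboveAntidiagonal P × shape P ≡ shape Q) × Dst P Q × faceOf P ≡ F
  interior⇒glideOrbit {F} (aboveF , collapse≡) =
    P , (aboveP , shape-cong-collapse P Q collapse-P≡Q) , (subst (Star SlideStep P) Q′≡Q slides , qyQ) ,
    complementQ-involutive F aboveF
    where
    P : Diagram n
    P = complementQ F
    aboveP : AboveAntidiagonal P
    aboveP = complementQ-aboveAntidiagonal F
    collapse-P≡Q : collapse (word P) ≡ collapse (word Q)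
    collapse-P≡Q = trans collapse≡ (sym (quasiYamanouchi-collapse aboveQ qyQ))
    Q′ : Diagram n
    Q′ = proj₁ (dst-exists P aboveP)
    slides : Star SlideStep P Q′
    slides = proj₁ (proj₂ (dst-exists P aboveP))
    qy′ : QuasiYamanouchi Q′
    qy′ = proj₂ (proj₂ (dst-exists P aboveP))
    aboveQ′ : AboveAntidiagonal Q′
    aboveQ′ = proj₁ (slides-invariant slides aboveP)
    Q′≡Q : Q′ ≡ Q
    Q′≡Q = quasiYamanouchi-word-injective aboveQ′ qy′ aboveQ qyQ (begin
      word Q′              ≡⟨ quasiYamanouchi-collapse aboveQ′ qy′ ⟨
      collapse (word Q′)   ≡⟨ proj₂ (slides-invariant slides aboveP) ⟨
      collapse (word P)    ≡⟨ collapse-P≡Q ⟩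
      collapse (word Q)    ≡⟨ quasiYamanouchi-collapse aboveQ qyQ ⟩
      word Q ∎)
      where open ≡-Reasoning

proposition4p9 : (n : ℕ) (w : List ℕ) → w ↭ upTo n → (Q : Diagram n) → InQPD w Q →
    ((P : Diagram n) → InPD w P → Dst P Q → InteriorSlide (word Q) (faceOf P))
  × ((P P′ : Diagram n) → InPD w P → Dst P Q → InPD w P′ → Dst P′ Q →
       faceOf P ≡ faceOf P′ → P ≡ P′)
  × ((F : Diagram n) → InteriorSlide (word Q) F →
       Σ (Diagram n) (λ P → InPD w P × Dst P Q × faceOf P ≡ F))
proposition4p9 n w _ Q ((aboveQ , shapeQ) , qyQ) =
    (λ P (aboveP , _) → glideOrbit⇒interior aboveQ qyQ aboveP)
  , (λ P P′ (aboveP , _) _ (aboveP′ , _) _ → faceOf-injective aboveP aboveP′)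
  , (λ F interior → let P , (aboveP , shape≡) , dst , face≡ = interior⇒glideOrbit aboveQ qyQ interior
                    in P , (aboveP , trans shape≡ shapeQ) , dst , face≡)
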